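{- In the Broadcast CONGEST model there is a deterministic algorithm that solves the $3$-approximate all-pairs shortest path problem for unweighted directed graphs in two rounds on every directed graph $G$ whose underlying undirected graph has diameter $1$.
   Context: Broadcast CONGEST model: a synchronous network of $n$ processors whose communication graph is the underlying undirected graph of the input directed graph $G$ (communication is bidirectional regardless of edge directions). Each vertex has a unique $O(\log n)$-bit identifier known to itself and its neighbours, and initially knows its own incoming and outgoing edges in $G$. In each round every vertex receives the messages sent to it in the previous round, performs unbounded local computation, and then sends one and the same message of $O(\log n)$ bits to all of its neighbours. Complexity is the number of rounds. Directed graphs are simple (anti-parallel edges allowed); underlying diameter $1$ means that between every two distinct vertices at least one directed edge is present. Writing $d(x,y,G)$ for the directed distance (number of edges of a shortest directed path, $\infty$ if none), the $3$-approximate APSP problem asks that every vertex compute, for every ordered pair $(x,y)$ of vertices, a value $\hat d(x,y)$ with $d(x,y,G)\le \hat d(x,y)\le 3\,d(x,y,G)$ (in particular $\hat d(x,y)=\infty$ exactly when $y$ is not reachable from $x$). -}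

module Defs where

open import Data.Nat using (ℕ; zero; suc; _+_; _*_; _^_; _≤_; _<_)
open import Data.Nat.Logarithm using (⌈log₂_⌉)
open import Data.Fin using (Fin)
open import Data.Bool using (Bool; true; false)
open import Data.List using (List; length)
open import Data.List.Membership.Propositional using (_∈_)
open import Data.Maybe using (Maybe; just; nothing)
open import Data.Product using (Σ; ∃; _×_; _,_)
open import Data.Sum using (_⊎_)
open import Data.Empty using (⊥)
open import Data.Unit using (⊤)
open import Relation.Nullary using (¬_)
open import Relation.Binary.PropositionalEquality using (_≡_; _≢_)
open import Function.Bundles using (_⇔_)

-- Directed graph: adjacency predicate as a Bool matrix (no multi-edges;
-- anti-parallel edges allowed).
DiGraph : ℕ → Set
DiGraph n = Fin n → Fin n → Bool

Edge : ∀ {n} → DiGraph n → Fin n → Fin n → Set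
Edge E u v = E u v ≡ true

Simple : ∀ {n} → DiGraph n → Set
Simple E = ∀ v → E v v ≡ false

Adj : ∀ {n} → DiGraph n → Fin n → Fin n → Set
Adj E u v = Edge E u v ⊎ Edge E v u

UnderlyingDiam1 : ∀ {n} → DiGraph n → Set
UnderlyingDiam1 E = ∀ u v → u ≢ v → Adj E u v

data Walk {n} (E : DiGraph n) : Fin n → Fin n → ℕ → Set where
  here : ∀ {x} → Walk E x x 0
  step : ∀ {x y z k} → Edge E x y → Walk E y z k → Walk E x z (suc k)

-- Directed distance; nothing encodes ∞.
IsDist : ∀ {n} → DiGraph n → Fin n → Fin n → Maybe ℕ → Set
IsDist E x y (just d) = Walk E x y d × (∀ k → Walk E x y k → d ≤ k)
IsDist E x y nothing  = ∀ k → ¬ Walk E x y k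

Approx3 : Maybe ℕ → Maybe ℕ → Set
Approx3 (just d) (just a) = d ≤ a × a ≤ 3 * d
Approx3 (just d) nothing  = ⊥
Approx3 nothing  (just a) = ⊥
Approx3 nothing  nothing  = ⊤

Msg : Set
Msg = List Bool

-- O(log n) bits, with constant c: at most c * (⌈log₂ n⌉ + 1) bits
Bits : ℕ → ℕ → ℕ
Bits c n = c * suc ⌈log₂ n ⌉

-- Initial local knowledge of a vertex:
-- (own identifier, identifiers of out-neighbours, identifiers of in-neighbours)
Local : Set
Local = ℕ × List ℕ × List ℕ

-- A deterministic two-round Broadcast CONGEST algorithm.
--  round 1: broadcast msg1 of the local input;
--  round 2: receive (senderId, message) pairs from all neighbours, broadcast msg2;
--  end:     receive round-2 messages and output d̂(x,y) for all identifiers x, y.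
record TwoRoundAlg : Set where
  field
    msg1   : Local → Msg
    msg2   : Local → List (ℕ × Msg) → Msg
    output : Local → List (ℕ × Msg) → List (ℕ × Msg) → ℕ → ℕ → Maybe ℕ

Enumerates : {A : Set} → List A → (A → Set) → Set
Enumerates {A} L P = ∀ (a : A) → (a ∈ L) ⇔ P a

ValidIds : ∀ n → ℕ → (Fin n → ℕ) → Set
ValidIds n k ID = (∀ u v → ID u ≡ ID v → u ≡ v) × (∀ v → ID v < 2 ^ Bits k n)

-- Correctness of a two-round algorithm on a network, for every admissible
-- enumeration order of local inputs and received messages.
CorrectOn : TwoRoundAlg → (c : ℕ) → ∀ n → DiGraph n → (Fin n → ℕ) → Set
CorrectOn A c n E ID =
  (outL inL : Fin n → List ℕ) →
  (∀ v → Enumerates (outL v) (λ m → ∃ λ u → Edge E v u × ID u ≡ m)) →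
  (∀ v → Enumerates (inL v) (λ m → ∃ λ u → Edge E u v × ID u ≡ m)) →
  let loc : Fin n → Local
      loc v = ID v , outL v , inL v
      m1 : Fin n → Msg
      m1 v = msg1 (loc v)
  in (r1 : Fin n → List (ℕ × Msg)) →
     (∀ v → Enumerates (r1 v) (λ p → ∃ λ u → Adj E v u × p ≡ (ID u , m1 u))) →
  let m2 : Fin n → Msg
      m2 v = msg2 (loc v) (r1 v)
  in (r2 : Fin n → List (ℕ × Msg)) →
     (∀ v → Enumerates (r2 v) (λ p → ∃ λ u → Adj E v u × p ≡ (ID u , m2 u))) →
     (∀ v → length (m1 v) ≤ Bits c n × length (m2 v) ≤ Bits c n)
     × (∀ w x y δ → IsDist E x y δ →
          Approx3 δ (output (loc w) (r1 w) (r2 w) (ID x) (ID y)))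
  where open TwoRoundAlg A

module Submission where

-- Key fact (degree lemma): if deg⁺ y ≤ deg⁺ z then y is reachable from z in at
-- most two steps.  For otherwise y → z, and every out-neighbour of z is an
-- out-neighbour of y, so deg⁺ y > deg⁺ z.
--
-- Round 1: every vertex broadcasts its out-degree.  Round 2: v
-- broadcasts deg⁺ v and its level F v, the largest out-degree among v and its
-- out-neighbours.  By diameter 1 every vertex now knows (id, deg⁺, F) of all
-- vertices, so it can compute, for each x, the levels T₀ = F x and
-- T_{i+1} = G(T_i) = max (T_i, max {F v | deg⁺ v ≤ T_i}), and output 3(j+1)
-- for the least j with deg⁺ y ≤ T_j (∞ if there is none).
--
-- Every vertex reached from x by a walk of length i+1 has
-- out-degree ≤ T_i (so d(x,y) ≥ j+1), and some vertex of out-degree exactly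
-- T_i is reachable within 3i+1 steps, from which y is reachable within two
-- more by the degree lemma (so d(x,y) ≤ 3(j+1)).  Since G is inflationary and
-- the levels are bounded, the search for j can stop after finitely many steps.

open import Defs
open import Data.Nat using (ℕ; zero; suc; _+_; _*_; _^_; _∸_; _≤_; _<_; z≤n; s≤s; _≟_; _≤?_)
open import Data.Nat.Properties
open import Data.Nat.Logarithm using (⌈log₂_⌉; ⌈log₂⌉-mono-≤; ⌈log₂2^n⌉≡n)
open import Data.Nat.GeneralisedArithmetic using (fold)
import Data.Nat.Binary as Bin
open Bin using (ℕᵇ; 2[1+_]; 1+[2_])
import Data.Nat.Binary.Properties as Bin
open import Data.Fin using (Fin)
import Data.Fin.Properties as Fin
open import Data.Bool using (Bool; true; false)
import Data.Bool as Bool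
open import Data.List using (List; []; _∷_; length; _++_; map; filter; deduplicate; allFin)
open import Data.List.Properties using (length-++; ++-identityʳ; length-map; length-tabulate; length-removeAt′)
open import Data.List.Extrema.Nat using (max; ⊥≤max; xs≤max; argmax-sel)
open import Data.List.Membership.Propositional using (_∈_)
open import Data.List.Membership.DecPropositional _≟_ using (_∈?_)
open import Data.List.Membership.Propositional.Properties
  using (∈-map⁺; ∈-map⁻; ∈-filter⁺; ∈-filter⁻; ∈-allFin; deduplicate-∈⇔)
open import Data.List.Relation.Unary.Any using (here; there; index; _─_)
import Data.List.Relation.Unary.All as All
open import Data.List.Relation.Unary.AllPairs using (_∷_)
open import Data.List.Relation.Unary.Unique.Propositional using (Unique)
open import Data.List.Relation.Unary.Unique.DecPropositional.Properties using (deduplicate-!)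
open import Data.Maybe using (Maybe; just; nothing)
import Data.Maybe as Maybe
open import Data.Product using (Σ; ∃; _×_; _,_; proj₁; proj₂; map₁)
open import Data.Sum using (_⊎_; inj₁; inj₂)
open import Data.Empty using (⊥; ⊥-elim)
open import Data.Unit using (tt)
open import Function using (_∘_)
open import Function.Bundles using (Equivalence)
import Function.Properties.Equivalence as ⇔
open import Relation.Nullary using (¬_; yes; no)
open import Relation.Nullary.Decidable using (_×-dec_)
open import Relation.Unary using (Decidable)
open import Relation.Binary.PropositionalEquality

∈-─ : ∀ {A : Set} {x a : A} {ys} (x∈ys : x ∈ ys) → a ∈ ys → a ≢ x → a ∈ (ys ─ x∈ys)
∈-─ (here refl) (here refl) a≢x = ⊥-elim (a≢x refl)
∈-─ (here refl) (there a∈ys) _  = a∈ys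
∈-─ (there _)   (here refl) _   = here refl
∈-─ (there x∈ys) (there a∈ys) a≢x = there (∈-─ x∈ys a∈ys a≢x)

unique⊆⇒length≤ : ∀ {A : Set} {xs ys : List A} →
                  Unique xs → (∀ {a} → a ∈ xs → a ∈ ys) → length xs ≤ length ys
unique⊆⇒length≤ {xs = []} _ _ = z≤n
unique⊆⇒length≤ {xs = x ∷ xs} {ys} (x∉xs ∷ xs-unique) xs⊆ys = begin
  suc (length xs)          ≤⟨ s≤s (unique⊆⇒length≤ xs-unique tail⊆ys─x) ⟩
  suc (length (ys ─ x∈ys)) ≡⟨ sym (length-removeAt′ ys (index x∈ys)) ⟩
  length ys                ∎
  where
  open ≤-Reasoning
  x∈ys : x ∈ ys
  x∈ys = xs⊆ys (here refl)
  tail⊆ys─x : ∀ {a} → a ∈ xs → a ∈ (ys ─ x∈ys)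
  tail⊆ys─x a∈xs = ∈-─ x∈ys (xs⊆ys (there a∈xs)) (λ a≡x → All.lookup x∉xs a∈xs (sym a≡x))

module _ {A : Set} {P : A → Set} (P? : Decidable P) (g : A → ℕ) where

  maxOver : ℕ → List A → ℕ
  maxOver b xs = max b (map g (filter P? xs))

  maxOver-≥default : ∀ b xs → b ≤ maxOver b xs
  maxOver-≥default b xs = ⊥≤max b (map g (filter P? xs))

  maxOver-≥member : ∀ b {x xs} → x ∈ xs → P x → g x ≤ maxOver b xs
  maxOver-≥member b {xs = xs} x∈xs px =
    All.lookup (xs≤max b (map g (filter P? xs))) (∈-map⁺ g (∈-filter⁺ P? x∈xs px))

  maxOver-attained : ∀ b xs → maxOver b xs ≡ b ⊎ ∃ λ x → x ∈ xs × P x × maxOver b xs ≡ g x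
  maxOver-attained b xs with argmax-sel (λ m → m) b (map g (filter P? xs))
  ... | inj₁ eq = inj₁ eq
  ... | inj₂ m∈ with ∈-map⁻ g m∈
  ...   | x , x∈filter , eq with ∈-filter⁻ P? x∈filter
  ...     | x∈xs , px = inj₂ (x , x∈xs , px , eq)

  maxOver-unique : ∀ {x c} xs → x ∈ xs → P x → (∀ {y} → y ∈ xs → P y → g y ≡ c) →
                   maxOver 0 xs ≡ c
  maxOver-unique {x} {c} xs x∈xs px all≡c = ≤-antisym upper lower
    where
    upper : maxOver 0 xs ≤ c
    upper with maxOver-attained 0 xs
    ... | inj₁ eq = subst (_≤ c) (sym eq) z≤n
    ... | inj₂ (y , y∈xs , py , eq) = ≤-reflexive (trans eq (all≡c y∈xs py))
    lower : c ≤ maxOver 0 xs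
    lower = subst (_≤ maxOver 0 xs) (all≡c x∈xs px) (maxOver-≥member 0 x∈xs px)

least : {P : ℕ → Set} → Decidable P → ℕ → Maybe ℕ
least P? zero = nothing
least P? (suc r) with least P? r
... | just i = just i
... | nothing with P? r
...   | yes _ = just r
...   | no _  = nothing

data Least (P : ℕ → Set) (r : ℕ) : Maybe ℕ → Set where
  none  : (∀ i → i < r → ¬ P i) → Least P r nothing
  found : ∀ {i} → P i → (∀ j → j < i → ¬ P j) → Least P r (just i)

least-spec : ∀ {P : ℕ → Set} (P? : Decidable P) r → Least P r (least P? r)
least-spec P? zero = none (λ _ ())
least-spec {P} P? (suc r) with least P? r | least-spec P? r
... | just i  | found pi below = found pi below
... | nothing | none below with P? r
...   | yes pr  = found pr below
...   | no ¬pr  = none below-suc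
  where
  below-suc : ∀ i → i < suc r → ¬ P i
  below-suc i i<1+r with m<1+n⇒m<n∨m≡n i<1+r
  ... | inj₁ i<r  = below i i<r
  ... | inj₂ refl = ¬pr

-- Orbits of an inflationary map f on ℕ: T i = fᶦ t.  A bounded orbit is
-- eventually constant, so its value at the bound dominates the whole orbit.
fold-shift : ∀ (f : ℕ → ℕ) t k → fold (f t) f k ≡ f (fold t f k)
fold-shift f t zero    = refl
fold-shift f t (suc k) = cong f (fold-shift f t k)

module Orbit (f : ℕ → ℕ) (inflationary : ∀ t → t ≤ f t) (t : ℕ) where

  T : ℕ → ℕ
  T = fold t f

  T-grows : ∀ p j → T j ≤ T (p + j)
  T-grows zero    j = ≤-refl
  T-grows (suc p) j = ≤-trans (T-grows p j) (inflationary (T (p + j)))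

  fixed-persists : ∀ {i} → T (suc i) ≡ T i → ∀ p → T (p + i) ≡ T i
  fixed-persists fix zero    = refl
  fixed-persists fix (suc p) = trans (cong f (fixed-persists fix p)) fix

  -- Before its first repetition the orbit increases strictly.
  stalls-or-grows : ∀ m → (∃ λ i → i < m × T (suc i) ≡ T i) ⊎ m ≤ T m
  stalls-or-grows zero = inj₂ z≤n
  stalls-or-grows (suc m) with stalls-or-grows m
  ... | inj₁ (i , i<m , fix) = inj₁ (i , m<n⇒m<1+n i<m , fix)
  ... | inj₂ m≤Tm with T (suc m) ≟ T m
  ...   | yes fix = inj₁ (m , ≤-refl , fix)
  ...   | no grows = inj₂ (≤-trans (s≤s m≤Tm) (≤∧≢⇒< (inflationary (T m)) (grows ∘ sym)))

  bounded-orbit-max : ∀ B → (∀ i → T i ≤ B) → ∀ j → T j ≤ T B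
  bounded-orbit-max B T≤B j with stalls-or-grows (suc B)
  ... | inj₂ 1+B≤T = ⊥-elim (<⇒≱ 1+B≤T (T≤B (suc B)))
  ... | inj₁ (i , i<1+B , fix) = begin
    T j           ≤⟨ T-grows i j ⟩
    T (i + j)     ≡⟨ cong T (+-comm i j) ⟩
    T (j + i)     ≡⟨ fixed-persists fix j ⟩
    T i           ≡⟨ sym (fixed-persists fix (B ∸ i)) ⟩
    T (B ∸ i + i) ≡⟨ cong T (m∸n+n≡m (m<1+n⇒m≤n i<1+B)) ⟩
    T B           ∎
    where open ≤-Reasoning

-- A self-delimiting binary code: every binary digit is preceded by `true`,
-- and `false` marks the end.  A code word of m ≤ n has O(log n) bits.
codeᵇ : ℕᵇ → List Bool
codeᵇ Bin.zero  = false ∷ []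
codeᵇ 2[1+ x ] = true ∷ true ∷ codeᵇ x
codeᵇ 1+[2 x ] = true ∷ false ∷ codeᵇ x

decodeᵇ : List Bool → ℕᵇ × List Bool
decodeᵇ (true ∷ true ∷ r)  = map₁ 2[1+_] (decodeᵇ r)
decodeᵇ (true ∷ false ∷ r) = map₁ 1+[2_] (decodeᵇ r)
decodeᵇ (false ∷ r)        = Bin.zero , r
decodeᵇ _                  = Bin.zero , []

decodeᵇ-codeᵇ : ∀ x r → decodeᵇ (codeᵇ x ++ r) ≡ (x , r)
decodeᵇ-codeᵇ Bin.zero  r = refl
decodeᵇ-codeᵇ 2[1+ x ] r = cong (map₁ 2[1+_]) (decodeᵇ-codeᵇ x r)
decodeᵇ-codeᵇ 1+[2 x ] r = cong (map₁ 1+[2_]) (decodeᵇ-codeᵇ x r)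

encode : ℕ → List Bool
encode m = codeᵇ (Bin.fromℕ m)

decode : List Bool → ℕ × List Bool
decode bits = map₁ Bin.toℕ (decodeᵇ bits)

decode-encode : ∀ m r → decode (encode m ++ r) ≡ (m , r)
decode-encode m r = begin
  map₁ Bin.toℕ (decodeᵇ (codeᵇ (Bin.fromℕ m) ++ r)) ≡⟨ cong (map₁ Bin.toℕ) (decodeᵇ-codeᵇ (Bin.fromℕ m) r) ⟩
  (Bin.toℕ (Bin.fromℕ m) , r)                       ≡⟨ cong (_, r) (Bin.toℕ-fromℕ m) ⟩
  (m , r)                                           ∎
  where open ≡-Reasoning

decode-encode-alone : ∀ m → proj₁ (decode (encode m)) ≡ m
decode-encode-alone m =
  cong proj₁ (subst (λ bits → decode bits ≡ (m , [])) (++-identityʳ (encode m)) (decode-encode m []))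

-- Two bits per binary digit plus the end marker.
length-codeᵇ : ∀ x → length (codeᵇ x) ≡ suc (2 * Bin.size x)
length-codeᵇ Bin.zero  = refl
length-codeᵇ 2[1+ x ] = trans (cong (2 +_) (length-codeᵇ x)) (cong suc (sym (*-suc 2 (Bin.size x))))
length-codeᵇ 1+[2 x ] = trans (cong (2 +_) (length-codeᵇ x)) (cong suc (sym (*-suc 2 (Bin.size x))))

2^size≤1+toℕ : ∀ x → 2 ^ Bin.size x ≤ suc (Bin.toℕ x)
2^size≤1+toℕ Bin.zero  = s≤s z≤n
2^size≤1+toℕ 2[1+ x ] = ≤-trans (*-monoʳ-≤ 2 (2^size≤1+toℕ x)) (n≤1+n _)
2^size≤1+toℕ 1+[2 x ] = subst (2 * 2 ^ Bin.size x ≤_) (*-suc 2 (Bin.toℕ x)) (*-monoʳ-≤ 2 (2^size≤1+toℕ x))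

size-fromℕ≤ : ∀ {m n} → m ≤ n → Bin.size (Bin.fromℕ m) ≤ suc ⌈log₂ n ⌉
size-fromℕ≤ {m} {n} m≤n = digits (Bin.size (Bin.fromℕ m))
  (subst (λ k → 2 ^ Bin.size (Bin.fromℕ m) ≤ suc k) (Bin.toℕ-fromℕ m) (2^size≤1+toℕ (Bin.fromℕ m)))
  where
  digits : ∀ s → 2 ^ s ≤ suc m → s ≤ suc ⌈log₂ n ⌉
  digits zero _ = z≤n
  digits (suc s) 2^1+s≤1+m = s≤s (begin
    s               ≡⟨ sym (⌈log₂2^n⌉≡n s) ⟩
    ⌈log₂ (2 ^ s) ⌉ ≤⟨ ⌈log₂⌉-mono-≤ (≤-trans 2^s≤m m≤n) ⟩
    ⌈log₂ n ⌉       ∎)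
    where
    open ≤-Reasoning
    2^s≤m : 2 ^ s ≤ m
    2^s≤m = m<1+n⇒m≤n (<-≤-trans (^-monoʳ-< 2 (s≤s (s≤s z≤n)) (n<1+n s)) 2^1+s≤1+m)

encode-length : ∀ {m n} → m ≤ n → length (encode m) ≤ 3 * suc ⌈log₂ n ⌉
encode-length {m} {n} m≤n = begin
  length (encode m)                    ≡⟨ length-codeᵇ (Bin.fromℕ m) ⟩
  suc (2 * Bin.size (Bin.fromℕ m))     ≤⟨ s≤s (*-monoʳ-≤ 2 (size-fromℕ≤ m≤n)) ⟩
  suc (2 * suc ⌈log₂ n ⌉)              ≤⟨ +-monoˡ-≤ (2 * suc ⌈log₂ n ⌉) (s≤s z≤n) ⟩
  3 * suc ⌈log₂ n ⌉                    ∎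
  where open ≤-Reasoning

_++ʷ_ : ∀ {n} {E : DiGraph n} {x y z k m} → Walk E x y k → Walk E y z m → Walk E x z (k + m)
here     ++ʷ q = q
step e p ++ʷ q = step e (p ++ʷ q)

walk0⇒≡ : ∀ {n} {E : DiGraph n} {x y} → Walk E x y 0 → x ≡ y
walk0⇒≡ here = refl

Within : ∀ {n} → DiGraph n → ℕ → Fin n → Fin n → Set
Within E k x y = ∃ λ j → j ≤ k × Walk E x y j

within-trans : ∀ {n} {E : DiGraph n} {k m x y z} → Within E k x y → Within E m y z → Within E (k + m) x z
within-trans (j , j≤k , p) (j′ , j′≤m , q) = j + j′ , +-mono-≤ j≤k j′≤m , p ++ʷ q

within-mono : ∀ {n} {E : DiGraph n} {k m x y} → k ≤ m → Within E k x y → Within E m x y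
within-mono k≤m (j , j≤k , p) = j , ≤-trans j≤k k≤m , p

approx-reachable : ∀ {n} {E : DiGraph n} {x y a} → Within E a x y → (∀ k → Walk E x y k → a ≤ 3 * k) →
                   ∀ δ → IsDist E x y δ → Approx3 δ (just a)
approx-reachable (k , k≤a , p) a≤3k (just d) (q , d-min) = ≤-trans (d-min k p) k≤a , a≤3k d q
approx-reachable (k , _ , p)   _    nothing  no-walk     = no-walk k p

approx-unreachable : ∀ {n} {E : DiGraph n} {x y} → (∀ k → ¬ Walk E x y k) →
                     ∀ δ → IsDist E x y δ → Approx3 δ nothing
approx-unreachable no-walk (just d) (p , _) = no-walk d p
approx-unreachable no-walk nothing  _       = tt

-- The degree lemma.  Out-neighbourhoods are given as duplicate-free lists N v
-- of labels (the vertices' identifiers, in the application), and the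
-- out-degree of v is the length of N v.
module OutDegree {n} {A : Set} (E : DiGraph n) (simple : Simple E) (diam1 : UnderlyingDiam1 E)
  (label : Fin n → A) (label-inj : ∀ u v → label u ≡ label v → u ≡ v)
  (N : Fin n → List A) (N-unique : ∀ v → Unique (N v))
  (N-spec : ∀ v → Enumerates (N v) (λ a → ∃ λ u → Edge E v u × label u ≡ a))
  where

  deg : Fin n → ℕ
  deg v = length (N v)

  ∈N : ∀ {v u} → Edge E v u → label u ∈ N v
  ∈N {v} {u} e = Equivalence.from (N-spec v (label u)) (u , e , refl)

  ∈N⁻ : ∀ {v a} → a ∈ N v → ∃ λ u → Edge E v u × label u ≡ a
  ∈N⁻ {v} {a} = Equivalence.to (N-spec v a)

  -- Labels of distinct vertices are distinct, so there are at most n of them.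
  deg≤n : ∀ v → deg v ≤ n
  deg≤n v = subst (deg v ≤_) (trans (length-map label (allFin n)) (length-tabulate (λ i → i)))
                  (unique⊆⇒length≤ (N-unique v) N⊆labels)
    where
    N⊆labels : ∀ {a} → a ∈ N v → a ∈ map label (allFin n)
    N⊆labels a∈N with ∈N⁻ a∈N
    ... | u , _ , refl = ∈-map⁺ label (∈-allFin u)

  label∉N : ∀ v → All.All (label v ≢_) (N v)
  label∉N v = All.tabulate λ a∈N eq → not-loop a∈N eq
    where
    not-loop : ∀ {a} → a ∈ N v → label v ≡ a → ⊥
    not-loop a∈N eq with ∈N⁻ a∈N
    ... | u , e , eq′ with label-inj u v (trans eq′ (sym eq))
    ...   | refl with trans (sym e) (simple v)
    ...     | ()

  -- If y is not reachable from z within two steps, then y → z and every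
  -- out-neighbour of z is an out-neighbour of y: y has strictly larger out-degree.
  dominates : ∀ {z y} → z ≢ y → ¬ Edge E z y → ¬ (∃ λ u → Edge E z u × Edge E u y) → deg z < deg y
  dominates {z} {y} z≢y ¬zy ¬path = unique⊆⇒length≤ (label∉N z ∷ N-unique z) z∷Nz⊆Ny
    where
    yz : Edge E y z
    yz with diam1 y z (z≢y ∘ sym)
    ... | inj₁ e  = e
    ... | inj₂ e  = ⊥-elim (¬zy e)
    z∷Nz⊆Ny : ∀ {a} → a ∈ label z ∷ N z → a ∈ N y
    z∷Nz⊆Ny (here refl) = ∈N yz
    z∷Nz⊆Ny (there a∈Nz) with ∈N⁻ a∈Nz
    ... | u , zu , refl with u Fin.≟ y
    ...   | yes refl = ⊥-elim (¬zy zu)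
    ...   | no u≢y with diam1 u y u≢y
    ...     | inj₁ uy = ⊥-elim (¬path (u , zu , uy))
    ...     | inj₂ yu = ∈N yu

  degree-lemma : ∀ {z y} → deg y ≤ deg z → Within E 2 z y
  degree-lemma {z} {y} dy≤dz with z Fin.≟ y
  ... | yes refl = 0 , z≤n , here
  ... | no z≢y with E z y Bool.≟ true
  ...   | yes zy = 1 , s≤s z≤n , step zy here
  ...   | no ¬zy with Fin.any? (λ u → (E z u Bool.≟ true) ×-dec (E u y Bool.≟ true))
  ...     | yes (u , zu , uy) = 2 , ≤-refl , step zu (step uy here)
  ...     | no ¬path = ⊥-elim (<⇒≱ (dominates z≢y ¬zy ¬path) dy≤dz)

-- The output for a pair x ≠ y, computed from the level map G, a bound B on all
-- levels, the out-degree dy of y and the level fx of x: 3(j+1) for the least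
-- j ≤ B with dy ≤ Gʲ fx.
estimate : (ℕ → ℕ) → ℕ → ℕ → ℕ → Maybe ℕ
estimate G B dy fx = Maybe.map (λ j → 3 * suc j) (least (λ i → dy ≤? fold fx G i) (suc B))

module Levels {n} (E : DiGraph n) (deg : Fin n → ℕ)
  (degree-lemma : ∀ {z y} → deg y ≤ deg z → Within E 2 z y)
  (F : Fin n → ℕ)
  (F-ge : ∀ {v u} → Edge E v u → deg u ≤ F v)
  (F-att : ∀ v → F v ≡ deg v ⊎ ∃ λ u → Edge E v u × F v ≡ deg u)
  (G : ℕ → ℕ)
  (G-infl : ∀ t → t ≤ G t)
  (G-ge : ∀ {v t} → deg v ≤ t → F v ≤ G t)
  (G-att : ∀ t → G t ≡ t ⊎ ∃ λ v → deg v ≤ t × G t ≡ F v)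
  (B : ℕ) (F≤B : ∀ v → F v ≤ B)
  where

  T : Fin n → ℕ → ℕ
  T x = fold (F x) G

  -- Every walk of length k+1 from u ends at a vertex of out-degree at most
  -- Gᵏ t, whenever F u ≤ t.  Hence d(x,y) > j if deg y exceeds T x j.
  walk-lower : ∀ {u v t} k → F u ≤ t → Walk E u v (suc k) → deg v ≤ fold t G k
  walk-lower zero    Fu≤t (step e here) = ≤-trans (F-ge e) Fu≤t
  walk-lower {v = v} {t} (suc k) Fu≤t (step e p) =
    subst (deg v ≤_) (fold-shift G t k) (walk-lower k (G-ge (≤-trans (F-ge e) Fu≤t)) p)

  -- A budget of 3i+1 steps plus the two of the degree lemma is 3(i+1).
  three-steps : ∀ i → (1 + 3 * i) + 2 ≡ 3 * suc i
  three-steps i = trans (+-assoc 1 (3 * i) 2) (trans (cong suc (+-comm (3 * i) 2)) (sym (*-suc 3 i)))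

  -- The i-th level is the out-degree of a vertex reachable within 3i+1 steps:
  -- each application of G costs at most two steps (degree lemma) plus one
  -- (to the out-neighbour realising the level).
  level-attained : ∀ x i → ∃ λ z → deg z ≡ T x i × Within E (1 + 3 * i) x z
  level-attained x zero with F-att x
  ... | inj₁ eq           = x , sym eq , 0 , z≤n , here
  ... | inj₂ (u , e , eq) = u , sym eq , 1 , ≤-refl , step e here
  level-attained x (suc i) with level-attained x i
  ... | z , dz≡Ti , x⇝z with G-att (T x i)
  ...   | inj₁ eq = z , trans dz≡Ti (sym eq) , within-mono (+-monoʳ-≤ 1 (*-monoʳ-≤ 3 (n≤1+n i))) x⇝z
  ...   | inj₂ (v , dv≤Ti , eq) with within-trans x⇝z (degree-lemma (subst (deg v ≤_) (sym dz≡Ti) dv≤Ti))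
  ...     | x⇝v with F-att v
  ...       | inj₁ eq′ = v , sym (trans eq eq′) ,
                         within-mono (≤-trans (≤-reflexive (three-steps i)) (n≤1+n _)) x⇝v
  ...       | inj₂ (u , e , eq′) = u , sym (trans eq eq′) ,
                         within-mono (≤-reflexive (trans (cong (_+ 1) (three-steps i)) (+-comm _ 1)))
                                     (within-trans x⇝v (1 , ≤-refl , step e here))

  -- The levels are bounded, hence they stop growing after at most B steps,
  -- which justifies stopping the search at B.
  T≤B : ∀ x i → T x i ≤ B
  T≤B x zero = F≤B x
  T≤B x (suc i) with G-att (T x i)
  ... | inj₁ eq           = subst (_≤ B) (sym eq) (T≤B x i)
  ... | inj₂ (v , _ , eq) = subst (_≤ B) (sym eq) (F≤B v)

  T≤T-B : ∀ x j → T x j ≤ T x B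
  T≤T-B x = Orbit.bounded-orbit-max G G-infl (F x) B (T≤B x)

  estimate-approx : ∀ {x y} → x ≢ y → ∀ δ → IsDist E x y δ → Approx3 δ (estimate G B (deg y) (F x))
  estimate-approx {x} {y} x≢y δ dist
    with least (λ i → deg y ≤? T x i) (suc B) | least-spec (λ i → deg y ≤? T x i) (suc B)
  ... | nothing | none below = approx-unreachable unreachable δ dist
    where
    unreachable : ∀ k → ¬ Walk E x y k
    unreachable zero    p = x≢y (walk0⇒≡ p)
    unreachable (suc k) p = below B ≤-refl (≤-trans (walk-lower k ≤-refl p) (T≤T-B x k))
  ... | just j  | found dy≤Tj below = approx-reachable x⇝y far δ dist
    where
    x⇝y : Within E (3 * suc j) x y
    x⇝y with level-attained x j
    ... | z , dz≡Tj , x⇝z = within-mono (≤-reflexive (three-steps j))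
                              (within-trans x⇝z (degree-lemma (subst (deg y ≤_) (sym dz≡Tj) dy≤Tj)))
    far : ∀ k → Walk E x y k → 3 * suc j ≤ 3 * k
    far zero    p = ⊥-elim (x≢y (walk0⇒≡ p))
    far (suc k) p = *-monoʳ-≤ 3 (s≤s (≮⇒≥ λ k<j → below k k<j (walk-lower k ≤-refl p)))

-- Local tables.  After round two a vertex holds one entry
-- (identifier, out-degree, level) per vertex; everything it outputs is a
-- maximum over this table.
Entry : Set
Entry = ℕ × ℕ × ℕ

entryDeg entryLevel : Entry → ℕ
entryDeg   (_ , d , _) = d
entryLevel (_ , _ , f) = f

levelStep : List Entry → ℕ → ℕ
levelStep tb t = maxOver (λ e → entryDeg e ≤? t) entryLevel t tb

maxLevel : List Entry → ℕ
maxLevel tb = max 0 (map entryLevel tb)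

degreeOf levelOf : List Entry → ℕ → ℕ
degreeOf tb a = maxOver (λ e → proj₁ e ≟ a) entryDeg   0 tb
levelOf  tb a = maxOver (λ e → proj₁ e ≟ a) entryLevel 0 tb

module Table {n} (ID : Fin n → ℕ) (ID-inj : ∀ u v → ID u ≡ ID v → u ≡ v)
  (deg F : Fin n → ℕ) (tb : List Entry)
  (complete : ∀ u → (ID u , deg u , F u) ∈ tb)
  (sound : ∀ {e} → e ∈ tb → ∃ λ u → e ≡ (ID u , deg u , F u))
  where

  levelStep-infl : ∀ t → t ≤ levelStep tb t
  levelStep-infl t = maxOver-≥default (λ e → entryDeg e ≤? t) entryLevel t tb

  levelStep-ge : ∀ {v t} → deg v ≤ t → F v ≤ levelStep tb t
  levelStep-ge {v} {t} = maxOver-≥member (λ e → entryDeg e ≤? t) entryLevel t (complete v)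

  levelStep-att : ∀ t → levelStep tb t ≡ t ⊎ ∃ λ v → deg v ≤ t × levelStep tb t ≡ F v
  levelStep-att t with maxOver-attained (λ e → entryDeg e ≤? t) entryLevel t tb
  ... | inj₁ eq = inj₁ eq
  ... | inj₂ (e , e∈tb , de≤t , eq) with sound e∈tb
  ...   | v , refl = inj₂ (v , de≤t , eq)

  F≤maxLevel : ∀ v → F v ≤ maxLevel tb
  F≤maxLevel v = All.lookup (xs≤max 0 (map entryLevel tb)) (∈-map⁺ entryLevel (complete v))

  entry-of : ∀ {e u} → e ∈ tb → proj₁ e ≡ ID u → e ≡ (ID u , deg u , F u)
  entry-of {u = u} e∈tb id≡ with sound e∈tb
  ... | v , refl with ID-inj v u id≡
  ...   | refl = refl

  degreeOf-ID : ∀ u → degreeOf tb (ID u) ≡ deg u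
  degreeOf-ID u = maxOver-unique (λ e → proj₁ e ≟ ID u) entryDeg tb (complete u) refl
                    (λ e∈tb id≡ → cong entryDeg (entry-of e∈tb id≡))

  levelOf-ID : ∀ u → levelOf tb (ID u) ≡ F u
  levelOf-ID u = maxOver-unique (λ e → proj₁ e ≟ ID u) entryLevel tb (complete u) refl
                   (λ e∈tb id≡ → cong entryLevel (entry-of e∈tb id≡))

outNbrs : Local → List ℕ
outNbrs (_ , outs , _) = outs

outDeg : Local → ℕ
outDeg l = length (deduplicate _≟_ (outNbrs l))

level : Local → List (ℕ × Msg) → ℕ
level l received = maxOver (λ p → proj₁ p ∈? outNbrs l) (proj₁ ∘ decode ∘ proj₂) (outDeg l) received

round1 : Local → Msg
round1 l = encode (outDeg l)

round2 : Local → List (ℕ × Msg) → Msg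
round2 l received = encode (outDeg l) ++ encode (level l received)

readEntry : ℕ × Msg → Entry
readEntry (i , m) = i , readSecond (decode m)
  where
  readSecond : ℕ × List Bool → ℕ × ℕ
  readSecond (a , rest) = a , proj₁ (decode rest)

readEntry-round2 : ∀ i a b → readEntry (i , encode a ++ encode b) ≡ (i , a , b)
readEntry-round2 i a b = begin
  readEntry (i , encode a ++ encode b)   ≡⟨ cong (λ p → i , proj₁ p , proj₁ (decode (proj₂ p))) (decode-encode a (encode b)) ⟩
  (i , a , proj₁ (decode (encode b)))    ≡⟨ cong (λ c → i , a , c) (decode-encode-alone b) ⟩
  (i , a , b)                            ∎
  where open ≡-Reasoning

table : Local → List (ℕ × Msg) → List (ℕ × Msg) → List Entry
table l r1 r2 = (proj₁ l , outDeg l , level l r1) ∷ map readEntry r2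

answer : Local → List (ℕ × Msg) → List (ℕ × Msg) → ℕ → ℕ → Maybe ℕ
answer l r1 r2 a b with a ≟ b
... | yes _ = just 0
... | no _  = estimate (levelStep tb) (maxLevel tb) (degreeOf tb b) (levelOf tb a)
  where tb = table l r1 r2

algorithm : TwoRoundAlg
algorithm = record { msg1 = round1 ; msg2 = round2 ; output = answer }

module Run {n} (E : DiGraph n) (ID : Fin n → ℕ)
  (simple : Simple E) (diam1 : UnderlyingDiam1 E) (ID-inj : ∀ u v → ID u ≡ ID v → u ≡ v)
  (outL inL : Fin n → List ℕ)
  (outL-spec : ∀ v → Enumerates (outL v) (λ m → ∃ λ u → Edge E v u × ID u ≡ m))
  (r1 : Fin n → List (ℕ × Msg))
  (r1-spec : ∀ v → Enumerates (r1 v) (λ p → ∃ λ u → Adj E v u × p ≡ (ID u , round1 (ID u , outL u , inL u))))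
  (r2 : Fin n → List (ℕ × Msg))
  (r2-spec : ∀ v → Enumerates (r2 v)
                     (λ p → ∃ λ u → Adj E v u × p ≡ (ID u , round2 (ID u , outL u , inL u) (r1 u))))
  where

  loc : Fin n → Local
  loc v = ID v , outL v , inL v

  nbrs : Fin n → List ℕ
  nbrs v = deduplicate _≟_ (outL v)

  nbrs-spec : ∀ v → Enumerates (nbrs v) (λ a → ∃ λ u → Edge E v u × ID u ≡ a)
  nbrs-spec v a = ⇔.trans (⇔.sym (deduplicate-∈⇔ _≟_)) (outL-spec v a)

  open OutDegree E simple diam1 ID ID-inj nbrs (λ v → deduplicate-! _≟_ (outL v)) nbrs-spec

  F : Fin n → ℕ
  F v = level (loc v) (r1 v)

  round1-read : ∀ u → proj₁ (decode (round1 (loc u))) ≡ deg u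
  round1-read u = decode-encode-alone (deg u)

  F-ge : ∀ {v u} → Edge E v u → deg u ≤ F v
  F-ge {v} {u} e = subst (_≤ F v) (round1-read u)
    (maxOver-≥member (λ p → proj₁ p ∈? outL v) (proj₁ ∘ decode ∘ proj₂) (deg v)
      (Equivalence.from (r1-spec v _) (u , inj₁ e , refl))
      (Equivalence.from (outL-spec v (ID u)) (u , e , refl)))

  F-att : ∀ v → F v ≡ deg v ⊎ ∃ λ u → Edge E v u × F v ≡ deg u
  F-att v with maxOver-attained (λ p → proj₁ p ∈? outL v) (proj₁ ∘ decode ∘ proj₂) (deg v) (r1 v)
  ... | inj₁ eq = inj₁ eq
  ... | inj₂ (p , p∈r1 , id∈outL , eq) with Equivalence.to (r1-spec v p) p∈r1
  ...   | u , _ , refl with Equivalence.to (outL-spec v (ID u)) id∈outL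
  ...     | u′ , e , id≡ with ID-inj u′ u id≡
  ...       | refl = inj₂ (u , e , trans eq (round1-read u))

  F≤n : ∀ v → F v ≤ n
  F≤n v with F-att v
  ... | inj₁ eq           = subst (_≤ n) (sym eq) (deg≤n v)
  ... | inj₂ (u , _ , eq) = subst (_≤ n) (sym eq) (deg≤n u)

  -- Both messages carry at most two code words of numbers ≤ n.
  message-lengths : ∀ v → length (round1 (loc v)) ≤ Bits 6 n × length (round2 (loc v) (r1 v)) ≤ Bits 6 n
  message-lengths v =
    ≤-trans (encode-length (deg≤n v)) (*-monoˡ-≤ L {3} {6} (s≤s (s≤s (s≤s z≤n)))) ,
    (begin
      length (encode (deg v) ++ encode (F v))           ≡⟨ length-++ (encode (deg v)) ⟩
      length (encode (deg v)) + length (encode (F v))   ≤⟨ +-mono-≤ (encode-length (deg≤n v)) (encode-length (F≤n v)) ⟩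
      3 * L + 3 * L                                     ≡⟨ sym (*-distribʳ-+ L 3 3) ⟩
      6 * L                                             ∎)
    where
    open ≤-Reasoning
    L : ℕ
    L = suc ⌈log₂ n ⌉

  module AtVertex (w : Fin n) where

    tb : List Entry
    tb = table (loc w) (r1 w) (r2 w)

    complete : ∀ u → (ID u , deg u , F u) ∈ tb
    complete u with w Fin.≟ u
    ... | yes refl = here refl
    ... | no w≢u   = there (subst (_∈ map readEntry (r2 w)) (readEntry-round2 (ID u) (deg u) (F u))
                       (∈-map⁺ readEntry (Equivalence.from (r2-spec w _) (u , diam1 w u w≢u , refl))))

    sound : ∀ {e} → e ∈ tb → ∃ λ u → e ≡ (ID u , deg u , F u)
    sound (here refl) = w , refl
    sound (there e∈tb) with ∈-map⁻ readEntry e∈tb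
    ... | p , p∈r2 , refl with Equivalence.to (r2-spec w p) p∈r2
    ...   | u , _ , refl = u , readEntry-round2 (ID u) (deg u) (F u)

    open Table ID ID-inj deg F tb complete sound
    open Levels E deg degree-lemma F F-ge F-att
                (levelStep tb) levelStep-infl levelStep-ge levelStep-att (maxLevel tb) F≤maxLevel

    answer-approx : ∀ x y δ → IsDist E x y δ → Approx3 δ (answer (loc w) (r1 w) (r2 w) (ID x) (ID y))
    answer-approx x y δ dist with ID x ≟ ID y
    ... | yes id≡ with ID-inj x y id≡
    ...   | refl = approx-reachable (0 , z≤n , here) (λ _ _ → z≤n) δ dist
    answer-approx x y δ dist | no id≢ =
      subst (Approx3 δ) (cong₂ (estimate (levelStep tb) (maxLevel tb)) (sym (degreeOf-ID y)) (sym (levelOf-ID x)))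
            (estimate-approx (id≢ ∘ cong ID) δ dist)

corollary9 : ∀ (k : ℕ) → ∃ λ (c : ℕ) → Σ TwoRoundAlg λ A →
               ∀ n (E : DiGraph n) (ID : Fin n → ℕ) →
               Simple E → UnderlyingDiam1 E → ValidIds n k ID →
               CorrectOn A c n E ID
corollary9 k = 6 , algorithm ,
  λ n E ID simple diam1 (ID-inj , _) outL inL outL-spec _ r1 r1-spec r2 r2-spec →
    let open Run E ID simple diam1 ID-inj outL inL outL-spec r1 r1-spec r2 r2-spec
    in message-lengths , AtVertex.answer-approx
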